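{- Let $\mathbb{F}_q$ be a finite field, $P,Q\in\mathbb{F}_q[X]\setminus\{0\}$ coprime with $\deg P>\deg Q$, $\mathcal{D}=\{s\in\mathbb{F}_q[X]:\deg s<\deg P\}$, and let $W_{P/Q}\subseteq\mathcal{D}^{\omega}$ be the $\omega$-language of the expansion graph $T(P/Q)$. If $\deg Q\ge1$, then $W_{P/Q}$ is not a regular $\omega$-language.
   Context: The expansion graph $T(P/Q)$ is the edge-labelled directed graph with vertex set $\mathbb{F}_q[X]$ in which there is an edge from $v$ to $w$ with label $s\in\mathcal{D}$ whenever $w=(Pv+s)/Q\in\mathbb{F}_q[X]$. $W_{P/Q}$ is the set of right-infinite words over $\mathcal{D}$ that are label sequences of infinite directed paths in $T(P/Q)$ starting at the vertex $0$. An $\omega$-language is regular if it is accepted by a Büchi automaton. -}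

module Defs where

open import Level using (0ℓ)
open import Data.Nat using (ℕ; zero; suc; _≤_; _<_)
open import Data.Fin using (Fin)
open import Data.Bool using (Bool; true; false; T; if_then_else_)
open import Data.List using (List; []; _∷_; length; map)
open import Data.List.Membership.Propositional using (_∈_)
open import Data.Product using (Σ; ∃; ∃-syntax; _×_; _,_)
open import Relation.Nullary using (¬_; Dec; yes; no)
open import Relation.Binary.PropositionalEquality using (_≡_)
open import Algebra.Structures using (IsCommutativeRing)

record FiniteField : Set₁ where
  field
    Carrier : Set
    _+_ _*_ : Carrier → Carrier → Carrier
    -_      : Carrier → Carrier
    0# 1#   : Carrier
    isCommutativeRing : IsCommutativeRing _≡_ _+_ _*_ -_ 0# 1#
    0≢1     : ¬ (0# ≡ 1#)
    inverse : ∀ x → ¬ (x ≡ 0#) → ∃[ y ] (x * y ≡ 1#)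
    _≟_     : (x y : Carrier) → Dec (x ≡ y)
    elements : List Carrier
    complete : ∀ x → x ∈ elements

-- Polynomials over F: coefficient lists, lowest degree first.
-- A list is normal when it has no trailing zero; the zero polynomial is [].

module Poly (F : FiniteField) where
  open FiniteField F renaming (_+_ to _+F_; _*_ to _*F_)

  Raw : Set
  Raw = List Carrier

  norm : Raw → Raw
  norm [] = []
  norm (x ∷ xs) with norm xs
  ... | [] with x ≟ 0#
  ...   | yes _ = []
  ...   | no  _ = x ∷ []
  norm (x ∷ xs) | y ∷ ys = x ∷ y ∷ ys

  Normal : Raw → Set
  Normal xs = norm xs ≡ xs

  _≈_ : Raw → Raw → Set
  xs ≈ ys = norm xs ≡ norm ys

  _⊕_ : Raw → Raw → Raw
  [] ⊕ ys = ys
  (x ∷ xs) ⊕ [] = x ∷ xs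
  (x ∷ xs) ⊕ (y ∷ ys) = (x +F y) ∷ (xs ⊕ ys)

  _⊗_ : Raw → Raw → Raw
  [] ⊗ ys = []
  (x ∷ xs) ⊗ ys = map (x *F_) ys ⊕ (0# ∷ (xs ⊗ ys))

  -- for a normal polynomial p, deg p = length p - 1 (and deg 0 = -∞),
  -- so  deg s < deg P  iff  length s < length P  (P ≠ 0).

  _∣_ : Raw → Raw → Set
  d ∣ p = ∃[ e ] ((d ⊗ e) ≈ p)

  -- coprime: every (normal) common divisor is a nonzero constant
  Coprime : Raw → Raw → Set
  Coprime p q = ∀ d → Normal d → d ∣ p → d ∣ q → length d ≡ 1

  Digit : Raw → Set
  Digit P = Σ Raw λ s → Normal s × length s < length P

  digit : {P : Raw} → Digit P → Raw
  digit (s , _) = s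

  -- edge v --s--> w in T(P/Q) iff  w = (P v + s) / Q,  i.e.  Q w = P v + s
  Edge : (P Q : Raw) → Raw → Raw → Raw → Set
  Edge P Q v s w = (Q ⊗ w) ≈ ((P ⊗ v) ⊕ s)

  W : (P Q : Raw) → (ℕ → Digit P) → Set
  W P Q word = Σ (ℕ → Raw) λ v → ((v 0 ≈ []) × (∀ i → Edge P Q (v i) (digit {P} (word i)) (v (suc i))))

record Buchi (A : Set) : Set where
  field
    states    : ℕ
    initial   : Fin states → Bool
    δ         : Fin states → A → Fin states → Bool
    accepting : Fin states → Bool

module _ {A : Set} (B : Buchi A) where
  open Buchi B

  Accepts : (ℕ → A) → Set
  Accepts w = Σ (ℕ → Fin states) λ ρ → (T (initial (ρ 0))
            × (∀ i → T (δ (ρ i) (w i) (ρ (suc i))))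
            × (∀ m → ∃[ k ] (m ≤ k × T (accepting (ρ k)))))

RegularΩ : {A : Set} → ((ℕ → A) → Set) → Set
RegularΩ {A} L = Σ (Buchi A) λ B → (∀ w → (L w → Accepts B w) × (Accepts B w → L w))

-- Dividing P·v by Q and taking as digit minus the remainder gives
-- an edge v → (P·v − remainder)/Q of T(P/Q) that raises the degree by
-- deg P − deg Q ≥ 1.  Starting with the edge 0 → 1 (digit Q), this yields
-- an infinite "greedy" path from 0 whose vertices are pairwise distinct;
-- its label sequence, the greedy word, lies in W_{P/Q}.  If a Büchi
-- automaton accepted exactly W_{P/Q}, its run on the greedy word would
-- repeat a state at two times a < b, so the word with the segment [a, b)
-- cut out would be accepted too, hence would label a path u from 0.
-- Edges are deterministic (Q·w = P·v + s determines w), so u follows the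
-- greedy path up to time a; afterwards u and the greedy path from time b
-- read the same digits, so their differences dₙ satisfy Q·dₙ₊₁ = P·dₙ.
-- By Euclid's lemma (P, Q coprime) every dₙ is divisible by Q and the
-- quotients satisfy the same recurrence with smaller degrees, because
-- deg Q ≥ 1; by descent d₀ = 0, i.e. the greedy path visits the same
-- vertex at times a and b, a contradiction.
module Submission where

open import Defs
open import Function using (_∘_)
open import Data.Nat using (ℕ; zero; suc; pred; _+_; _∸_; _≤_; _<_; _≤?_; _<?_; z≤n; s≤s)
import Data.Nat.Properties as ℕ
open import Data.Nat.Properties
  using (≤-refl; ≤-trans; <-trans; ≤-pred; <⇒≤; <⇒≱; ≰⇒>; m≤n⇒m≤1+n; m≤n⇒m<n∨m≡n; ≤∧≢⇒<
        ; m≤m+n; m≤n+m; +-monoˡ-≤; +-mono-<-≤; +-∸-assoc; m+n∸n≡m; m+[n∸m]≡n; m∸n+n≡m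
        ; n∸n≡0; m+n≤o⇒m≤o∸n; m+n≤o⇒n≤o; n<1+n)
open import Data.Fin using (Fin; toℕ)
open import Data.Fin.Properties using (pigeonhole)
open import Data.Bool using (T)
open import Data.List using ([]; _∷_; length; map)
open import Data.Product using (Σ; ∃-syntax; _×_; _,_; proj₁; proj₂)
open import Data.Sum using (_⊎_; inj₁; inj₂)
open import Data.Empty using (⊥)
open import Relation.Nullary using (¬_; yes; no; contradiction)
open import Level using (0ℓ)
open import Algebra.Bundles using (CommutativeRing)
open import Algebra.Structures using (IsCommutativeRing)
import Algebra.Properties.Ring as RingProperties
import Algebra.Properties.AbelianGroup as AbelianGroupProperties
open import Relation.Binary.Bundles using (Setoid)
import Relation.Binary.Reasoning.Setoid as SetoidReasoning
open import Relation.Binary.PropositionalEquality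
  using (_≡_; refl; sym; trans; cong; cong₂; subst; subst₂; module ≡-Reasoning)

module PumpingDown {A : Set} (B : Buchi A) where
  open Buchi B

  -- a sequence of states repeats (pigeonhole on the first states + 1 terms)
  repeats : (ρ : ℕ → Fin states) → ∃[ a ] ∃[ b ] a < b × ρ a ≡ ρ b
  repeats ρ with pigeonhole (n<1+n states) (ρ ∘ toℕ)
  ... | i , j , i<j , same = toℕ i , toℕ j , i<j , same

  skip : ℕ → ℕ → ℕ → ℕ
  skip a b k with k <? a
  ... | yes _ = k
  ... | no  _ = (k ∸ a) + b

  skip-below : ∀ {a b k} → k < a → skip a b k ≡ k
  skip-below {a} {b} {k} k<a with k <? a
  ... | yes _   = refl
  ... | no  k≮a = contradiction k<a k≮a

  skip-above : ∀ a b {k} → a ≤ k → skip a b k ≡ (k ∸ a) + b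
  skip-above a b {k} a≤k with k <? a
  ... | yes k<a = contradiction a≤k (<⇒≱ k<a)
  ... | no  _   = refl

  skip-shift : ∀ a b n → skip a b (n + a) ≡ n + b
  skip-shift a b n = trans (skip-above a b (m≤n+m a n)) (cong (_+ b) (m+n∸n≡m n a))

  module _ (ρ : ℕ → Fin states) {a b : ℕ} (loop : ρ a ≡ ρ b) where

    skip-agrees : ∀ {j} → j ≤ a → ρ (skip a b j) ≡ ρ j
    skip-agrees {j} j≤a with m≤n⇒m<n∨m≡n j≤a
    ... | inj₁ j<a  = cong ρ (skip-below {b = b} j<a)
    ... | inj₂ refl = trans (cong ρ (trans (skip-above j b ≤-refl) (cong (_+ b) (n∸n≡0 j)))) (sym loop)

    skip-step : ∀ k → ρ (skip a b (suc k)) ≡ ρ (suc (skip a b k))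
    skip-step k with a ≤? k
    ... | no  a≰k = trans (skip-agrees k<a) (cong (ρ ∘ suc) (sym (skip-below {b = b} k<a)))
      where
      k<a : k < a
      k<a = ≰⇒> a≰k
    ... | yes a≤k = cong ρ (begin
          skip a b (suc k)      ≡⟨ skip-above a b (m≤n⇒m≤1+n a≤k) ⟩
          (suc k ∸ a) + b       ≡⟨ cong (_+ b) (+-∸-assoc 1 a≤k) ⟩
          suc ((k ∸ a) + b)     ≡⟨ cong suc (sym (skip-above a b a≤k)) ⟩
          suc (skip a b k)      ∎)
      where open ≡-Reasoning

  accepts-skip : ∀ {w} (acc : Accepts B w) {a b} → proj₁ acc a ≡ proj₁ acc b →
                 Accepts B (w ∘ skip a b)
  accepts-skip {w} (ρ , ρ-initial , ρ-step , ρ-often) {a} {b} loop =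
    ρ ∘ skip a b ,
    subst (T ∘ initial) (sym (skip-agrees ρ loop z≤n)) ρ-initial ,
    (λ k → subst (T ∘ δ _ _) (sym (skip-step ρ loop k)) (ρ-step (skip a b k))) ,
    often
    where
    -- an accepting visit at time k ≥ m + b is the skipped run's visit at
    -- time (k ∸ b) + a ≥ m
    often : ∀ m → ∃[ k ] (m ≤ k × T (accepting (ρ (skip a b k))))
    often m with ρ-often (m + b)
    ... | k , m+b≤k , k-accepting =
      (k ∸ b) + a ,
      ≤-trans (m+n≤o⇒m≤o∸n m m+b≤k) (m≤m+n (k ∸ b) a) ,
      subst (T ∘ accepting ∘ ρ) (sym lands) k-accepting
      where
      lands : skip a b ((k ∸ b) + a) ≡ k
      lands = trans (skip-shift a b (k ∸ b)) (m∸n+n≡m (m+n≤o⇒n≤o m m+b≤k))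

  pump-down : ∀ {w} → Accepts B w → ∃[ a ] ∃[ b ] a < b × Accepts B (w ∘ skip a b)
  pump-down acc with repeats (proj₁ acc)
  ... | a , b , a<b , loop = a , b , a<b , accepts-skip acc loop

-- Arithmetic of coefficient lists over a finite field, up to
-- coefficientwise equality _≋_.
module PolynomialArithmetic (F : FiniteField) where
  open FiniteField F
    renaming (_+_ to infixl 6 _+F_; _*_ to infixl 7 _*F_; -_ to infix 8 -F_)
  open IsCommutativeRing isCommutativeRing
    using ( +-assoc; +-comm; +-identityˡ; +-identityʳ; -‿inverseʳ
          ; *-assoc; *-comm; *-identityˡ; distribˡ; zeroˡ; zeroʳ)
  open Poly F

  private
    Fring : CommutativeRing 0ℓ 0ℓ
    Fring = record { isCommutativeRing = isCommutativeRing }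
  open RingProperties (CommutativeRing.ring Fring) using (-1*x≈-x)
  open AbelianGroupProperties (CommutativeRing.+-abelianGroup Fring)
    using (ε⁻¹≈ε; x∙y⁻¹≈ε⇒x≈y; x≈y⇒x∙y⁻¹≈ε)

  coeff : Raw → ℕ → Carrier
  coeff []       k       = 0#
  coeff (x ∷ xs) zero    = x
  coeff (x ∷ xs) (suc k) = coeff xs k

  -- Coefficientwise equality.  It is the equality the algebra is done
  -- with; it agrees with the normal-form equality _≈_ of Defs (see ≋⇒≈).
  infix 4 _≋_
  record _≋_ (a b : Raw) : Set where
    constructor coeffwise
    field at : ∀ k → coeff a k ≡ coeff b k
  open _≋_ public

  ≋-refl : ∀ {a} → a ≋ a
  ≋-refl = coeffwise λ _ → refl

  ≋-sym : ∀ {a b} → a ≋ b → b ≋ a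
  ≋-sym e = coeffwise λ k → sym (at e k)

  ≋-trans : ∀ {a b c} → a ≋ b → b ≋ c → a ≋ c
  ≋-trans e f = coeffwise λ k → trans (at e k) (at f k)

  ≋-setoid : Setoid 0ℓ 0ℓ
  ≋-setoid = record
    { Carrier = Raw ; _≈_ = _≋_
    ; isEquivalence = record { refl = ≋-refl ; sym = ≋-sym ; trans = ≋-trans } }

  module ≋-Reasoning = SetoidReasoning ≋-setoid

  ∷-cong : ∀ {x y a b} → x ≡ y → a ≋ b → x ∷ a ≋ y ∷ b
  ∷-cong e f = coeffwise λ { zero → e ; (suc k) → at f k }

  ∷-tail : ∀ {x y a b} → x ∷ a ≋ y ∷ b → a ≋ b
  ∷-tail e = coeffwise λ k → at e (suc k)

  0∷-zero : ∀ {a} → a ≋ [] → 0# ∷ a ≋ []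
  0∷-zero e = coeffwise λ { zero → refl ; (suc k) → at e k }

  -- Addition and scalar multiplication are computed coefficientwise, so
  -- their laws are the field's laws applied at every coefficient.
  scale : Carrier → Raw → Raw
  scale c = map (c *F_)

  coeff-⊕ : ∀ a b k → coeff (a ⊕ b) k ≡ coeff a k +F coeff b k
  coeff-⊕ []      b       k       = sym (+-identityˡ _)
  coeff-⊕ (x ∷ a) []      k       = sym (+-identityʳ _)
  coeff-⊕ (x ∷ a) (y ∷ b) zero    = refl
  coeff-⊕ (x ∷ a) (y ∷ b) (suc k) = coeff-⊕ a b k

  coeff-scale : ∀ c a k → coeff (scale c a) k ≡ c *F coeff a k
  coeff-scale c []      k       = sym (zeroʳ c)
  coeff-scale c (x ∷ a) zero    = refl
  coeff-scale c (x ∷ a) (suc k) = coeff-scale c a k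

  ⊕-cong : ∀ {a a' b b'} → a ≋ a' → b ≋ b' → a ⊕ b ≋ a' ⊕ b'
  ⊕-cong {a} {a'} {b} {b'} e f = coeffwise λ k → begin
    coeff (a ⊕ b) k            ≡⟨ coeff-⊕ a b k ⟩
    coeff a k +F coeff b k     ≡⟨ cong₂ _+F_ (at e k) (at f k) ⟩
    coeff a' k +F coeff b' k   ≡⟨ coeff-⊕ a' b' k ⟨
    coeff (a' ⊕ b') k          ∎
    where open ≡-Reasoning

  scale-cong : ∀ c {a b} → a ≋ b → scale c a ≋ scale c b
  scale-cong c {a} {b} e = coeffwise λ k →
    trans (coeff-scale c a k) (trans (cong (c *F_) (at e k)) (sym (coeff-scale c b k)))

  ⊕-comm : ∀ a b → a ⊕ b ≋ b ⊕ a
  ⊕-comm a b = coeffwise λ k →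
    trans (coeff-⊕ a b k) (trans (+-comm _ _) (sym (coeff-⊕ b a k)))

  ⊕-assoc : ∀ a b c → (a ⊕ b) ⊕ c ≋ a ⊕ (b ⊕ c)
  ⊕-assoc a b c = coeffwise λ k → begin
    coeff ((a ⊕ b) ⊕ c) k                   ≡⟨ coeff-⊕ (a ⊕ b) c k ⟩
    coeff (a ⊕ b) k +F coeff c k            ≡⟨ cong (_+F coeff c k) (coeff-⊕ a b k) ⟩
    (coeff a k +F coeff b k) +F coeff c k   ≡⟨ +-assoc _ _ _ ⟩
    coeff a k +F (coeff b k +F coeff c k)   ≡⟨ cong (coeff a k +F_) (coeff-⊕ b c k) ⟨
    coeff a k +F coeff (b ⊕ c) k            ≡⟨ coeff-⊕ a (b ⊕ c) k ⟨
    coeff (a ⊕ (b ⊕ c)) k                   ∎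
    where open ≡-Reasoning

  ⊕-identityʳ : ∀ a → a ⊕ [] ≋ a
  ⊕-identityʳ a = coeffwise λ k → trans (coeff-⊕ a [] k) (+-identityʳ _)

  ⊕-swap : ∀ a b c → a ⊕ (b ⊕ c) ≋ b ⊕ (a ⊕ c)
  ⊕-swap a b c = begin
    a ⊕ (b ⊕ c)   ≈⟨ ⊕-assoc a b c ⟨
    (a ⊕ b) ⊕ c   ≈⟨ ⊕-cong (⊕-comm a b) ≋-refl ⟩
    (b ⊕ a) ⊕ c   ≈⟨ ⊕-assoc b a c ⟩
    b ⊕ (a ⊕ c)   ∎
    where open ≋-Reasoning

  ⊕-interchange : ∀ a b c d → (a ⊕ b) ⊕ (c ⊕ d) ≋ (a ⊕ c) ⊕ (b ⊕ d)
  ⊕-interchange a b c d = begin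
    (a ⊕ b) ⊕ (c ⊕ d)   ≈⟨ ⊕-assoc a b (c ⊕ d) ⟩
    a ⊕ (b ⊕ (c ⊕ d))   ≈⟨ ⊕-cong (≋-refl {a}) (⊕-swap b c d) ⟩
    a ⊕ (c ⊕ (b ⊕ d))   ≈⟨ ⊕-assoc a c (b ⊕ d) ⟨
    (a ⊕ c) ⊕ (b ⊕ d)   ∎
    where open ≋-Reasoning

  scale-⊕ : ∀ c a b → scale c (a ⊕ b) ≋ scale c a ⊕ scale c b
  scale-⊕ c a b = coeffwise λ k → begin
    coeff (scale c (a ⊕ b)) k                          ≡⟨ coeff-scale c (a ⊕ b) k ⟩
    c *F coeff (a ⊕ b) k                               ≡⟨ cong (c *F_) (coeff-⊕ a b k) ⟩
    c *F (coeff a k +F coeff b k)                      ≡⟨ distribˡ c _ _ ⟩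
    c *F coeff a k +F c *F coeff b k                   ≡⟨ cong₂ _+F_ (coeff-scale c a k) (coeff-scale c b k) ⟨
    coeff (scale c a) k +F coeff (scale c b) k         ≡⟨ coeff-⊕ (scale c a) (scale c b) k ⟨
    coeff (scale c a ⊕ scale c b) k                    ∎
    where open ≡-Reasoning

  scale-scale : ∀ c x b → scale c (scale x b) ≋ scale (c *F x) b
  scale-scale c x b = coeffwise λ k → begin
    coeff (scale c (scale x b)) k   ≡⟨ coeff-scale c (scale x b) k ⟩
    c *F coeff (scale x b) k        ≡⟨ cong (c *F_) (coeff-scale x b k) ⟩
    c *F (x *F coeff b k)           ≡⟨ *-assoc c x _ ⟨
    (c *F x) *F coeff b k           ≡⟨ coeff-scale (c *F x) b k ⟨
    coeff (scale (c *F x) b) k      ∎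
    where open ≡-Reasoning

  scale-zero : ∀ b → scale 0# b ≋ []
  scale-zero b = coeffwise λ k → trans (coeff-scale 0# b k) (zeroˡ _)

  ⊗-congʳ : ∀ a {b b'} → b ≋ b' → a ⊗ b ≋ a ⊗ b'
  ⊗-congʳ []      e = ≋-refl
  ⊗-congʳ (x ∷ a) e = ⊕-cong (scale-cong x e) (∷-cong refl (⊗-congʳ a e))

  ⊗-zeroʳ : ∀ a → a ⊗ [] ≋ []
  ⊗-zeroʳ []      = ≋-refl
  ⊗-zeroʳ (x ∷ a) = 0∷-zero (⊗-zeroʳ a)

  ⊗-∷ʳ : ∀ a y b → a ⊗ (y ∷ b) ≋ scale y a ⊕ (0# ∷ (a ⊗ b))
  ⊗-∷ʳ []      y b = coeffwise λ { zero → refl ; (suc k) → refl }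
  ⊗-∷ʳ (x ∷ a) y b = ∷-cong (cong (_+F 0#) (*-comm x y)) (begin
    scale x b ⊕ (a ⊗ (y ∷ b))                  ≈⟨ ⊕-cong (≋-refl {scale x b}) (⊗-∷ʳ a y b) ⟩
    scale x b ⊕ (scale y a ⊕ (0# ∷ (a ⊗ b)))   ≈⟨ ⊕-swap (scale x b) (scale y a) _ ⟩
    scale y a ⊕ (scale x b ⊕ (0# ∷ (a ⊗ b)))   ∎)
    where open ≋-Reasoning

  ⊗-comm : ∀ a b → a ⊗ b ≋ b ⊗ a
  ⊗-comm []      b = ≋-sym (⊗-zeroʳ b)
  ⊗-comm (x ∷ a) b =
    ≋-trans (⊕-cong (≋-refl {scale x b}) (∷-cong refl (⊗-comm a b))) (≋-sym (⊗-∷ʳ b x a))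

  ⊗-congˡ : ∀ {a a'} b → a ≋ a' → a ⊗ b ≋ a' ⊗ b
  ⊗-congˡ {a} {a'} b e = ≋-trans (⊗-comm a b) (≋-trans (⊗-congʳ b e) (⊗-comm b a'))

  ⊗-distribˡ : ∀ a b c → a ⊗ (b ⊕ c) ≋ (a ⊗ b) ⊕ (a ⊗ c)
  ⊗-distribˡ []      b c = ≋-refl
  ⊗-distribˡ (x ∷ a) b c = begin
    scale x (b ⊕ c) ⊕ (0# ∷ (a ⊗ (b ⊕ c)))
      ≈⟨ ⊕-cong (scale-⊕ x b c) (∷-cong (sym (+-identityʳ 0#)) (⊗-distribˡ a b c)) ⟩
    (scale x b ⊕ scale x c) ⊕ ((0# ∷ (a ⊗ b)) ⊕ (0# ∷ (a ⊗ c)))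
      ≈⟨ ⊕-interchange (scale x b) (scale x c) _ _ ⟩
    (scale x b ⊕ (0# ∷ (a ⊗ b))) ⊕ (scale x c ⊕ (0# ∷ (a ⊗ c)))
      ∎
    where open ≋-Reasoning

  ⊗-distribʳ : ∀ a b c → (a ⊕ b) ⊗ c ≋ (a ⊗ c) ⊕ (b ⊗ c)
  ⊗-distribʳ a b c = begin
    (a ⊕ b) ⊗ c           ≈⟨ ⊗-comm (a ⊕ b) c ⟩
    c ⊗ (a ⊕ b)           ≈⟨ ⊗-distribˡ c a b ⟩
    (c ⊗ a) ⊕ (c ⊗ b)     ≈⟨ ⊕-cong (⊗-comm c a) (⊗-comm c b) ⟩
    (a ⊗ c) ⊕ (b ⊗ c)     ∎
    where open ≋-Reasoning

  scale-⊗ : ∀ c a b → scale c a ⊗ b ≋ scale c (a ⊗ b)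
  scale-⊗ c []      b = ≋-refl
  scale-⊗ c (x ∷ a) b = begin
    scale (c *F x) b ⊕ (0# ∷ (scale c a ⊗ b))
      ≈⟨ ⊕-cong (≋-sym (scale-scale c x b)) (∷-cong (sym (zeroʳ c)) (scale-⊗ c a b)) ⟩
    scale c (scale x b) ⊕ scale c (0# ∷ (a ⊗ b))
      ≈⟨ scale-⊕ c (scale x b) (0# ∷ (a ⊗ b)) ⟨
    scale c (scale x b ⊕ (0# ∷ (a ⊗ b)))
      ∎
    where open ≋-Reasoning

  ⊗-assoc : ∀ a b c → (a ⊗ b) ⊗ c ≋ a ⊗ (b ⊗ c)
  ⊗-assoc []      b c = ≋-refl
  ⊗-assoc (x ∷ a) b c = begin
    (scale x b ⊕ (0# ∷ (a ⊗ b))) ⊗ c          ≈⟨ ⊗-distribʳ (scale x b) _ c ⟩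
    (scale x b ⊗ c) ⊕ ((0# ∷ (a ⊗ b)) ⊗ c)    ≈⟨ ⊕-cong (scale-⊗ x b c) shifted ⟩
    scale x (b ⊗ c) ⊕ (0# ∷ (a ⊗ (b ⊗ c)))    ∎
    where
    open ≋-Reasoning
    shifted : (0# ∷ (a ⊗ b)) ⊗ c ≋ 0# ∷ (a ⊗ (b ⊗ c))
    shifted = ≋-trans (⊕-cong (scale-zero c) ≋-refl) (∷-cong refl (⊗-assoc a b c))

  ⊗-identityˡ : ∀ a → (1# ∷ []) ⊗ a ≋ a
  ⊗-identityˡ a = coeffwise λ k → begin
    coeff (scale 1# a ⊕ (0# ∷ [])) k              ≡⟨ coeff-⊕ (scale 1# a) (0# ∷ []) k ⟩
    coeff (scale 1# a) k +F coeff (0# ∷ []) k     ≡⟨ cong₂ _+F_ (coeff-scale 1# a k) (at (0∷-zero ≋-refl) k) ⟩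
    1# *F coeff a k +F 0#                         ≡⟨ +-identityʳ _ ⟩
    1# *F coeff a k                               ≡⟨ *-identityˡ _ ⟩
    coeff a k                                     ∎
    where open ≡-Reasoning

  neg : Raw → Raw
  neg = scale (-F 1#)

  infixl 6 _⊖_
  _⊖_ : Raw → Raw → Raw
  a ⊖ b = a ⊕ neg b

  coeff-neg : ∀ a k → coeff (neg a) k ≡ -F coeff a k
  coeff-neg a k = trans (coeff-scale (-F 1#) a k) (-1*x≈-x _)

  coeff-⊖ : ∀ a b k → coeff (a ⊖ b) k ≡ coeff a k +F -F coeff b k
  coeff-⊖ a b k = trans (coeff-⊕ a (neg b) k) (cong (coeff a k +F_) (coeff-neg b k))

  ⊖-cong : ∀ {a a' b b'} → a ≋ a' → b ≋ b' → a ⊖ b ≋ a' ⊖ b'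
  ⊖-cong e f = ⊕-cong e (scale-cong (-F 1#) f)

  ⊖-zero⇒≋ : ∀ {a b} → a ⊖ b ≋ [] → a ≋ b
  ⊖-zero⇒≋ {a} {b} e = coeffwise λ k → x∙y⁻¹≈ε⇒x≈y _ _ (trans (sym (coeff-⊖ a b k)) (at e k))

  ≋⇒⊖-zero : ∀ {a b} → a ≋ b → a ⊖ b ≋ []
  ≋⇒⊖-zero {a} {b} e = coeffwise λ k → trans (coeff-⊖ a b k) (x≈y⇒x∙y⁻¹≈ε (at e k))

  ⊕-⊖-cancel : ∀ a b → (a ⊕ b) ⊖ b ≋ a
  ⊕-⊖-cancel a b = begin
    (a ⊕ b) ⊖ b     ≈⟨ ⊕-assoc a b (neg b) ⟩
    a ⊕ (b ⊖ b)     ≈⟨ ⊕-cong (≋-refl {a}) (≋⇒⊖-zero (≋-refl {b})) ⟩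
    a ⊕ []          ≈⟨ ⊕-identityʳ a ⟩
    a               ∎
    where open ≋-Reasoning

  ⊖-⊕-cancel : ∀ a b → (a ⊖ b) ⊕ b ≋ a
  ⊖-⊕-cancel a b = begin
    (a ⊖ b) ⊕ b      ≈⟨ ⊕-assoc a (neg b) b ⟩
    a ⊕ (neg b ⊕ b)  ≈⟨ ⊕-cong (≋-refl {a}) (≋-trans (⊕-comm (neg b) b) (≋⇒⊖-zero (≋-refl {b}))) ⟩
    a ⊕ []           ≈⟨ ⊕-identityʳ a ⟩
    a                ∎
    where open ≋-Reasoning

  ⊖-common : ∀ a b s → (a ⊕ s) ⊖ (b ⊕ s) ≋ a ⊖ b
  ⊖-common a b s = begin
    (a ⊕ s) ⊕ neg (b ⊕ s)        ≈⟨ ⊕-cong (≋-refl {a ⊕ s}) (scale-⊕ (-F 1#) b s) ⟩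
    (a ⊕ s) ⊕ (neg b ⊕ neg s)    ≈⟨ ⊕-interchange a s (neg b) (neg s) ⟩
    (a ⊖ b) ⊕ (s ⊖ s)            ≈⟨ ⊕-cong (≋-refl {a ⊖ b}) (≋⇒⊖-zero (≋-refl {s})) ⟩
    (a ⊖ b) ⊕ []                 ≈⟨ ⊕-identityʳ (a ⊖ b) ⟩
    a ⊖ b                        ∎
    where open ≋-Reasoning

  ⊗-distribˡ-⊖ : ∀ m a b → m ⊗ (a ⊖ b) ≋ (m ⊗ a) ⊖ (m ⊗ b)
  ⊗-distribˡ-⊖ m a b = begin
    m ⊗ (a ⊕ neg b)           ≈⟨ ⊗-distribˡ m a (neg b) ⟩
    (m ⊗ a) ⊕ (m ⊗ neg b)     ≈⟨ ⊕-cong (≋-refl {m ⊗ a}) m⊗neg ⟩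
    (m ⊗ a) ⊖ (m ⊗ b)         ∎
    where
    open ≋-Reasoning
    m⊗neg : m ⊗ neg b ≋ neg (m ⊗ b)
    m⊗neg = ≋-trans (⊗-comm m (neg b))
              (≋-trans (scale-⊗ (-F 1#) b m) (scale-cong (-F 1#) (⊗-comm b m)))

  -- Degrees.  Bounded a n says deg a < n (all coefficients from X^n on
  -- vanish); Exact a d says deg a = d.
  Bounded : Raw → ℕ → Set
  Bounded a n = ∀ k → n ≤ k → coeff a k ≡ 0#

  Exact : Raw → ℕ → Set
  Exact a d = (¬ coeff a d ≡ 0#) × Bounded a (suc d)

  bounded-length : ∀ a → Bounded a (length a)
  bounded-length []      k       _         = refl
  bounded-length (x ∷ a) (suc k) (s≤s le) = bounded-length a k le

  bounded-≋ : ∀ {a b n} → a ≋ b → Bounded a n → Bounded b n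
  bounded-≋ e B k le = trans (sym (at e k)) (B k le)

  bounded-mono : ∀ {a n n'} → n ≤ n' → Bounded a n → Bounded a n'
  bounded-mono le B k le' = B k (≤-trans le le')

  bounded-⊕ : ∀ {a b n} → Bounded a n → Bounded b n → Bounded (a ⊕ b) n
  bounded-⊕ {a} {b} A B k le =
    trans (coeff-⊕ a b k) (trans (cong₂ _+F_ (A k le) (B k le)) (+-identityʳ 0#))

  bounded-neg : ∀ {a n} → Bounded a n → Bounded (neg a) n
  bounded-neg {a} A k le = trans (coeff-neg a k) (trans (cong -F_ (A k le)) ε⁻¹≈ε)

  bounded-zero : ∀ {a} → Bounded a 0 → a ≋ []
  bounded-zero B = coeffwise λ k → B k z≤n

  bounded-tail : ∀ {x a n} → Bounded (x ∷ a) (suc n) → Bounded a n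
  bounded-tail B k le = B (suc k) (s≤s le)

  bounded-lower : ∀ {a n} → Bounded a (suc n) → coeff a n ≡ 0# → Bounded a n
  bounded-lower {a} {n} B z k n≤k with k ℕ.≟ n
  ... | yes refl = z
  ... | no  k≢n  = B k (≤∧≢⇒< n≤k (k≢n ∘ sym))

  nonzero-below-bound : ∀ {a j n} → ¬ coeff a j ≡ 0# → Bounded a n → j < n
  nonzero-below-bound {a} {j} {n} nz B with n ≤? j
  ... | yes n≤j = contradiction (B j n≤j) nz
  ... | no  n≰j = ≰⇒> n≰j

  zero-or-exact : ∀ a → a ≋ [] ⊎ ∃[ d ] Exact a d
  zero-or-exact []      = inj₁ ≋-refl
  zero-or-exact (x ∷ a) with zero-or-exact a
  ... | inj₂ (d , nz , B) = inj₂ (suc d , nz , λ { (suc k) (s≤s le) → B k le })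
  ... | inj₁ a≋0 with x ≟ 0#
  ...   | yes x≡0 = inj₁ (coeffwise λ { zero → x≡0 ; (suc k) → at a≋0 k })
  ...   | no  x≢0 = inj₂ (0 , x≢0 , λ { (suc k) (s≤s le) → at a≋0 k })

  exact-≋ : ∀ {a b d} → a ≋ b → Exact a d → Exact b d
  exact-≋ e (nz , B) = (λ z → nz (trans (at e _) z)) , bounded-≋ e B

  exact-nonzero : ∀ {a d} → Exact a d → ¬ a ≋ []
  exact-nonzero (nz , B) e = nz (at e _)

  *-nonzero : ∀ {x y} → ¬ x ≡ 0# → ¬ y ≡ 0# → ¬ x *F y ≡ 0#
  *-nonzero {x} {y} x≢0 y≢0 xy≡0 with inverse x x≢0
  ... | x⁻¹ , xx⁻¹≡1 = y≢0 (begin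
    y                  ≡⟨ *-identityˡ y ⟨
    1# *F y            ≡⟨ cong (_*F y) (trans (sym xx⁻¹≡1) (*-comm x x⁻¹)) ⟩
    (x⁻¹ *F x) *F y    ≡⟨ *-assoc _ _ _ ⟩
    x⁻¹ *F (x *F y)    ≡⟨ cong (x⁻¹ *F_) xy≡0 ⟩
    x⁻¹ *F 0#          ≡⟨ zeroʳ x⁻¹ ⟩
    0#                 ∎)
    where open ≡-Reasoning

  coeff-⊗-top : ∀ a b m n → Bounded a (suc m) → Bounded b (suc n) →
                coeff (a ⊗ b) (m + n) ≡ coeff a m *F coeff b n
  coeff-⊗-top []      b m       n A B = sym (zeroˡ _)
  coeff-⊗-top (x ∷ a) b zero    n A B = begin
    coeff (scale x b ⊕ (0# ∷ (a ⊗ b))) n               ≡⟨ coeff-⊕ (scale x b) _ n ⟩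
    coeff (scale x b) n +F coeff (0# ∷ (a ⊗ b)) n      ≡⟨ cong₂ _+F_ (coeff-scale x b n) (at a⊗b≋0 n) ⟩
    x *F coeff b n +F 0#                               ≡⟨ +-identityʳ _ ⟩
    x *F coeff b n                                     ∎
    where
    open ≡-Reasoning
    a⊗b≋0 : 0# ∷ (a ⊗ b) ≋ []
    a⊗b≋0 = 0∷-zero (⊗-congˡ b (bounded-zero {a} (bounded-tail A)))
  coeff-⊗-top (x ∷ a) b (suc m) n A B = begin
    coeff (scale x b ⊕ (0# ∷ (a ⊗ b))) (suc (m + n))        ≡⟨ coeff-⊕ (scale x b) _ (suc (m + n)) ⟩
    coeff (scale x b) (suc (m + n)) +F coeff (a ⊗ b) (m + n)
      ≡⟨ cong₂ _+F_ (trans (coeff-scale x b _) (trans (cong (x *F_) (B _ (s≤s (m≤n+m n m)))) (zeroʳ x)))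
                    (coeff-⊗-top a b m n (bounded-tail A) B) ⟩
    0# +F coeff a m *F coeff b n                             ≡⟨ +-identityˡ _ ⟩
    coeff a m *F coeff b n                                   ∎
    where open ≡-Reasoning

  bounded-⊗ : ∀ a b m n → Bounded a (suc m) → Bounded b n → Bounded (a ⊗ b) (m + n)
  bounded-⊗ []      b m n A B k le = refl
  bounded-⊗ (x ∷ a) b m n A B k le = begin
    coeff (scale x b ⊕ (0# ∷ (a ⊗ b))) k              ≡⟨ coeff-⊕ (scale x b) _ k ⟩
    coeff (scale x b) k +F coeff (0# ∷ (a ⊗ b)) k     ≡⟨ cong₂ _+F_ head-vanishes (tail-vanishes m k le A) ⟩
    0# +F 0#                                          ≡⟨ +-identityʳ 0# ⟩
    0#                                                ∎
    where
    open ≡-Reasoning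
    head-vanishes : coeff (scale x b) k ≡ 0#
    head-vanishes = trans (coeff-scale x b k)
                      (trans (cong (x *F_) (B k (≤-trans (m≤n+m n m) le))) (zeroʳ x))
    tail-vanishes : ∀ m k → m + n ≤ k → Bounded (x ∷ a) (suc m) → coeff (0# ∷ (a ⊗ b)) k ≡ 0#
    tail-vanishes m       zero    le       A = refl
    tail-vanishes zero    (suc k) le       A = at (⊗-congˡ b (bounded-zero {a} (bounded-tail A))) k
    tail-vanishes (suc m) (suc k) (s≤s le) A = bounded-⊗ a b m n (bounded-tail A) B k le

  exact-⊗ : ∀ {a b m n} → Exact a m → Exact b n → Exact (a ⊗ b) (m + n)
  exact-⊗ {a} {b} {m} {n} (na , A) (nb , B) =
    (λ e → *-nonzero na nb (trans (sym (coeff-⊗-top a b m n A B)) e)) ,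
    subst (Bounded (a ⊗ b)) (ℕ.+-suc m n) (bounded-⊗ a b m (suc n) A B)

  ⊗-cancelˡ : ∀ {r m a b} → Exact r m → r ⊗ a ≋ r ⊗ b → a ≋ b
  ⊗-cancelˡ {r} {m} {a} {b} r-exact e with zero-or-exact (a ⊖ b)
  ... | inj₁ a⊖b≋0           = ⊖-zero⇒≋ a⊖b≋0
  ... | inj₂ (d , a⊖b-exact) = contradiction
          (≋-trans (⊗-distribˡ-⊖ r a b) (≋⇒⊖-zero e))
          (exact-nonzero (exact-⊗ {r} {a ⊖ b} r-exact a⊖b-exact))

  -- Normal forms.  norm drops trailing zeros without changing any
  -- coefficient; hence coefficientwise equality is equality of normal
  -- forms, and the length of a normal form is one more than the degree.

  cons-norm : Carrier → Raw → Raw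
  cons-norm x [] with x ≟ 0#
  ... | yes _ = []
  ... | no  _ = x ∷ []
  cons-norm x (y ∷ ys) = x ∷ y ∷ ys

  norm-∷ : ∀ x xs → norm (x ∷ xs) ≡ cons-norm x (norm xs)
  norm-∷ x xs with norm xs
  ... | [] with x ≟ 0#
  ...   | yes _ = refl
  ...   | no  _ = refl
  norm-∷ x xs | y ∷ ys = refl

  cons-norm-zero : ∀ {x} → x ≡ 0# → cons-norm x [] ≡ []
  cons-norm-zero {x} x≡0 with x ≟ 0#
  ... | yes _   = refl
  ... | no  x≢0 = contradiction x≡0 x≢0

  coeff-cons-norm : ∀ x l k → coeff (cons-norm x l) k ≡ coeff (x ∷ l) k
  coeff-cons-norm x []      k with x ≟ 0#
  coeff-cons-norm x []      zero    | yes x≡0 = sym x≡0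
  coeff-cons-norm x []      (suc k) | yes _   = refl
  ... | no _ = refl
  coeff-cons-norm x (y ∷ l) k = refl

  norm-≋ : ∀ a → norm a ≋ a
  norm-≋ []      = ≋-refl
  norm-≋ (x ∷ a) rewrite norm-∷ x a = coeffwise λ k →
    trans (coeff-cons-norm x (norm a) k) (at (∷-cong refl (norm-≋ a)) k)

  ≈⇒≋ : ∀ {a b} → a ≈ b → a ≋ b
  ≈⇒≋ {a} {b} e = ≋-trans (≋-sym (norm-≋ a)) (subst (_≋ b) (sym e) (norm-≋ b))

  ≋⇒≈ : ∀ {a b} → a ≋ b → a ≈ b
  ≋⇒≈ {[]}    {[]}    e = refl
  ≋⇒≈ {[]}    {y ∷ b} e rewrite norm-∷ y b | sym (≋⇒≈ {[]} {b} (coeffwise λ k → at e (suc k))) =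
    sym (cons-norm-zero (sym (at e 0)))
  ≋⇒≈ {x ∷ a} {[]}    e rewrite norm-∷ x a | ≋⇒≈ {a} {[]} (coeffwise λ k → at e (suc k)) =
    cons-norm-zero (at e 0)
  ≋⇒≈ {x ∷ a} {y ∷ b} e rewrite norm-∷ x a | norm-∷ y b =
    cong₂ cons-norm (at e 0) (≋⇒≈ {a} {b} (∷-tail e))

  norm-normal : ∀ a → Normal (norm a)
  norm-normal a = ≋⇒≈ (norm-≋ a)

  cons-norm-last : ∀ x l → (∀ m → length l ≡ suc m → ¬ coeff l m ≡ 0#) →
                   ∀ m → length (cons-norm x l) ≡ suc m → ¬ coeff (cons-norm x l) m ≡ 0#
  cons-norm-last x []      _    m       _  with x ≟ 0#
  cons-norm-last x []      _    m       () | yes _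
  cons-norm-last x []      _    zero    _  | no x≢0 = x≢0
  cons-norm-last x []      _    (suc m) () | no _
  cons-norm-last x (y ∷ l) last (suc m) e = last m (cong pred e)

  norm-last : ∀ a m → length (norm a) ≡ suc m → ¬ coeff (norm a) m ≡ 0#
  norm-last []      m ()
  norm-last (x ∷ a) rewrite norm-∷ x a = cons-norm-last x (norm a) (norm-last a)

  length-norm-≤ : ∀ {a n} → Bounded a n → length (norm a) ≤ n
  length-norm-≤ {a} {n} B with length (norm a) in eq
  ... | zero  = z≤n
  ... | suc m with n ≤? m
  ...   | yes n≤m = contradiction (trans (at (norm-≋ a) m) (B m n≤m)) (norm-last a m eq)
  ...   | no  n≰m = ≰⇒> n≰m

  normal-exact : ∀ {P d} → Normal P → length P ≡ suc d → Exact P d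
  normal-exact {P} {d} P-normal len =
    (λ z → norm-last P d (trans (cong length P-normal) len) (trans (cong (λ l → coeff l d) P-normal) z)) ,
    subst (Bounded P) len (bounded-length P)

  length-norm-1⇒constant : ∀ {a} → length (norm a) ≡ 1 → Bounded a 1
  length-norm-1⇒constant {a} len k le =
    trans (sym (at (norm-≋ a) k)) (bounded-length (norm a) k (subst (_≤ k) (sym len) le))

  record Division (r : Raw) (m : ℕ) (a : Raw) : Set where
    field
      quotient remainder : Raw
      identity        : a ≋ (r ⊗ quotient) ⊕ remainder
      remainder-small : Bounded remainder m

    remainder-≋ : a ⊖ (r ⊗ quotient) ≋ remainder
    remainder-≋ = begin
      a ⊖ rq                    ≈⟨ ⊖-cong identity (≋-refl {rq}) ⟩
      (rq ⊕ remainder) ⊖ rq     ≈⟨ ⊖-cong (⊕-comm rq remainder) (≋-refl {rq}) ⟩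
      (remainder ⊕ rq) ⊖ rq     ≈⟨ ⊕-⊖-cancel remainder rq ⟩
      remainder                 ∎
      where
      open ≋-Reasoning
      rq : Raw
      rq = r ⊗ quotient

    exact-if-zero : remainder ≋ [] → a ≋ r ⊗ quotient
    exact-if-zero ρ≋0 =
      ≋-trans identity (≋-trans (⊕-cong (≋-refl {r ⊗ quotient}) ρ≋0) (⊕-identityʳ (r ⊗ quotient)))

  monomial : ℕ → Carrier → Raw
  monomial zero    β = β ∷ []
  monomial (suc k) β = 0# ∷ monomial k β

  coeff-monomial : ∀ k β → coeff (monomial k β) k ≡ β
  coeff-monomial zero    β = refl
  coeff-monomial (suc k) β = coeff-monomial k β

  bounded-monomial : ∀ k β → Bounded (monomial k β) (suc k)
  bounded-monomial zero    β (suc j) le       = refl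
  bounded-monomial (suc k) β (suc j) (s≤s le) = bounded-monomial k β j le

  cancel-top : ∀ {r m a n} → Exact r m → m ≤ n → Bounded a (suc n) →
               ∃[ s ] Bounded (a ⊖ (r ⊗ s)) n
  cancel-top {r} {m} {a} {n} (r-top≢0 , r-bounded) m≤n a-bounded
    with inverse (coeff r m) r-top≢0
  ... | c⁻¹ , cc⁻¹≡1 = s , bounded-lower {a ⊖ (r ⊗ s)} difference-bounded top-cancels
    where
    α : Carrier
    α = coeff a n
    s : Raw
    s = monomial (n ∸ m) (c⁻¹ *F α)
    m+k≡n : m + (n ∸ m) ≡ n
    m+k≡n = m+[n∸m]≡n m≤n
    top-of-rs : coeff (r ⊗ s) n ≡ α
    top-of-rs = begin
      coeff (r ⊗ s) n              ≡⟨ cong (coeff (r ⊗ s)) (sym m+k≡n) ⟩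
      coeff (r ⊗ s) (m + (n ∸ m))  ≡⟨ coeff-⊗-top r s m (n ∸ m) r-bounded (bounded-monomial _ _) ⟩
      coeff r m *F coeff s (n ∸ m) ≡⟨ cong (coeff r m *F_) (coeff-monomial (n ∸ m) _) ⟩
      coeff r m *F (c⁻¹ *F α)      ≡⟨ *-assoc _ _ _ ⟨
      (coeff r m *F c⁻¹) *F α      ≡⟨ cong (_*F α) cc⁻¹≡1 ⟩
      1# *F α                      ≡⟨ *-identityˡ α ⟩
      α                            ∎
      where open ≡-Reasoning
    rs-bounded : Bounded (r ⊗ s) (suc n)
    rs-bounded = subst (Bounded (r ⊗ s)) (trans (ℕ.+-suc m (n ∸ m)) (cong suc m+k≡n))
                   (bounded-⊗ r s m (suc (n ∸ m)) r-bounded (bounded-monomial _ _))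
    difference-bounded : Bounded (a ⊖ (r ⊗ s)) (suc n)
    difference-bounded = bounded-⊕ {a} a-bounded (bounded-neg {r ⊗ s} rs-bounded)
    top-cancels : coeff (a ⊖ (r ⊗ s)) n ≡ 0#
    top-cancels = trans (coeff-⊖ a (r ⊗ s) n)
                    (trans (cong (λ c → α +F -F c) top-of-rs) (-‿inverseʳ α))

  trivial-division : ∀ {r m a} → Bounded a m → Division r m a
  trivial-division {r} {m} {a} a-bounded = record
    { quotient = [] ; remainder = a
    ; identity = ≋-sym (⊕-cong (⊗-zeroʳ r) (≋-refl {a}))
    ; remainder-small = a-bounded }

  divide-bounded : ∀ {r m} → Exact r m → ∀ n a → Bounded a n → Division r m a
  divide-bounded {r} {m} r-exact zero    a B = trivial-division (bounded-mono {a} z≤n B)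
  divide-bounded {r} {m} r-exact (suc n) a B with m ≤? n
  ... | no  m≰n = trivial-division (bounded-mono {a} (≰⇒> m≰n) B)
  ... | yes m≤n with cancel-top {r} {m} {a} r-exact m≤n B
  ...   | s , B' = record
          { quotient = q ⊕ s ; remainder = ρ ; identity = a≋ ; remainder-small = ρ-small }
    where
    open Division (divide-bounded {r} r-exact n (a ⊖ (r ⊗ s)) B')
      renaming (quotient to q; remainder to ρ; identity to a'≋; remainder-small to ρ-small)
    a≋ : a ≋ (r ⊗ (q ⊕ s)) ⊕ ρ
    a≋ = begin
      a                            ≈⟨ ⊖-⊕-cancel a (r ⊗ s) ⟨
      (a ⊖ (r ⊗ s)) ⊕ (r ⊗ s)      ≈⟨ ⊕-cong a'≋ (≋-refl {r ⊗ s}) ⟩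
      ((r ⊗ q) ⊕ ρ) ⊕ (r ⊗ s)      ≈⟨ ⊕-assoc (r ⊗ q) ρ (r ⊗ s) ⟩
      (r ⊗ q) ⊕ (ρ ⊕ (r ⊗ s))      ≈⟨ ⊕-cong (≋-refl {r ⊗ q}) (⊕-comm ρ (r ⊗ s)) ⟩
      (r ⊗ q) ⊕ ((r ⊗ s) ⊕ ρ)      ≈⟨ ⊕-assoc (r ⊗ q) (r ⊗ s) ρ ⟨
      ((r ⊗ q) ⊕ (r ⊗ s)) ⊕ ρ      ≈⟨ ⊕-cong (≋-sym (⊗-distribˡ r q s)) (≋-refl {ρ}) ⟩
      (r ⊗ (q ⊕ s)) ⊕ ρ            ∎
      where open ≋-Reasoning

  divide : ∀ r {m} → Exact r m → ∀ a → Division r m a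
  divide r r-exact a = divide-bounded {r} r-exact (length a) a (bounded-length a)

-- The expansion graph T(P/Q), with edges read up to coefficientwise
-- equality: v ─[ s ]→ w  iff  Q·w = P·v + s.
module ExpansionGraph (F : FiniteField) (P Q : Poly.Raw F) where
  open FiniteField F using (0#; 1#; 0≢1; _≟_; isCommutativeRing) renaming (_+_ to _+F_)
  open IsCommutativeRing isCommutativeRing using (+-identityʳ)
  open Poly F
  open PolynomialArithmetic F

  infix 4 _─[_]→_
  _─[_]→_ : Raw → Raw → Raw → Set
  v ─[ s ]→ w = Q ⊗ w ≋ (P ⊗ v) ⊕ s

  edge-difference : ∀ {v v' w w' s} → v ─[ s ]→ w → v' ─[ s ]→ w' →
                    Q ⊗ (w ⊖ w') ≋ P ⊗ (v ⊖ v')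
  edge-difference {v} {v'} {w} {w'} {s} e e' = begin
    Q ⊗ (w ⊖ w')                          ≈⟨ ⊗-distribˡ-⊖ Q w w' ⟩
    (Q ⊗ w) ⊖ (Q ⊗ w')                    ≈⟨ ⊖-cong e e' ⟩
    ((P ⊗ v) ⊕ s) ⊖ ((P ⊗ v') ⊕ s)        ≈⟨ ⊖-common (P ⊗ v) (P ⊗ v') s ⟩
    (P ⊗ v) ⊖ (P ⊗ v')                    ≈⟨ ⊗-distribˡ-⊖ P v v' ⟨
    P ⊗ (v ⊖ v')                          ∎
    where open ≋-Reasoning

  Q∣_ : Raw → Set
  Q∣ a = ∃[ e ] Q ⊗ e ≋ a

  Q∣-≋ : ∀ {a b} → a ≋ b → Q∣ a → Q∣ b
  Q∣-≋ a≋b (e , Qe≋a) = e , ≋-trans Qe≋a a≋b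

  Q∣P⊗-⊖ : ∀ {x y} → Q∣ (P ⊗ x) → Q∣ (P ⊗ y) → Q∣ (P ⊗ (x ⊖ y))
  Q∣P⊗-⊖ {x} {y} (e , Qe≋Px) (f , Qf≋Py) =
    e ⊖ f , ≋-trans (⊗-distribˡ-⊖ Q e f) (≋-trans (⊖-cong Qe≋Px Qf≋Py) (≋-sym (⊗-distribˡ-⊖ P x y)))

  Q∣P⊗-⊗ : ∀ {x} c → Q∣ (P ⊗ x) → Q∣ (P ⊗ (x ⊗ c))
  Q∣P⊗-⊗ {x} c (e , Qe≋Px) =
    e ⊗ c , ≋-trans (≋-sym (⊗-assoc Q e c)) (≋-trans (⊗-congˡ c Qe≋Px) (⊗-assoc P x c))

  Q∣P⊗Q : Q∣ (P ⊗ Q)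
  Q∣P⊗Q = P , ⊗-comm Q P

  Orbit : (ℕ → Raw) → Set
  Orbit d = ∀ n → Q ⊗ d (suc n) ≋ P ⊗ d n

  module _ {dQ : ℕ} (Q-exact : Exact Q dQ) where

    edge-deterministic : ∀ {v v' w w' s} → v ─[ s ]→ w → v' ─[ s ]→ w' → v ≋ v' → w ≋ w'
    edge-deterministic {v} {v'} {w} {w'} e e' v≋v' =
      ⊖-zero⇒≋ (⊗-cancelˡ {Q} Q-exact (begin
        Q ⊗ (w ⊖ w')     ≈⟨ edge-difference e e' ⟩
        P ⊗ (v ⊖ v')     ≈⟨ ⊗-congʳ P (≋⇒⊖-zero v≋v') ⟩
        P ⊗ []           ≈⟨ ⊗-zeroʳ P ⟩
        []               ≈⟨ ⊗-zeroʳ Q ⟨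
        Q ⊗ []           ∎))
      where open ≋-Reasoning

    module _ (coprime : Coprime P Q) where

      -- The heart of Euclid's lemma: if deg r < deg Q and Q ∣ P·r then
      -- r = 0.  By induction on a bound B > deg r: if deg r = B − 1,
      -- dividing Q by r gives Q = r·a + r' with Q ∣ P·r' and deg r' < deg r,
      -- so r' = 0; then a divides both Q and P, hence is constant, and
      -- deg Q = deg r < deg Q.
      no-small-solution : ∀ B r → Bounded r B → Bounded r dQ → Q∣ (P ⊗ r) → r ≋ []
      no-small-solution zero    r r<B _    _ = bounded-zero {r} r<B
      no-small-solution (suc B) r r<B r<dQ Q∣Pr with coeff r B ≟ 0#
      ... | yes top≡0 = no-small-solution B r (bounded-lower {r} r<B top≡0) r<dQ Q∣Pr
      ... | no  top≢0 = contradiction (trans (at Q≋ra dQ) ra-top) (proj₁ Q-exact)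
        where
        r-exact : Exact r B
        r-exact = top≢0 , r<B
        open Division (divide r r-exact Q)
          renaming (quotient to a; remainder to r'; remainder-small to r'<B)
        r'≋0 : r' ≋ []
        r'≋0 = no-small-solution B r' r'<B
                 (bounded-mono {r'} (<⇒≤ (nonzero-below-bound {r} top≢0 r<dQ)) r'<B)
                 (Q∣-≋ (⊗-congʳ P remainder-≋) (Q∣P⊗-⊖ Q∣P⊗Q (Q∣P⊗-⊗ a Q∣Pr)))
        Q≋ra : Q ≋ r ⊗ a
        Q≋ra = exact-if-zero r'≋0
        e : Raw
        e = proj₁ Q∣Pr
        ae≋P : a ⊗ e ≋ P
        ae≋P = ⊗-cancelˡ {r} r-exact (begin
          r ⊗ (a ⊗ e)   ≈⟨ ⊗-assoc r a e ⟨
          (r ⊗ a) ⊗ e   ≈⟨ ⊗-congˡ e (≋-sym Q≋ra) ⟩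
          Q ⊗ e         ≈⟨ proj₂ Q∣Pr ⟩
          P ⊗ r         ≈⟨ ⊗-comm P r ⟩
          r ⊗ P         ∎)
          where open ≋-Reasoning
        a-constant : Bounded a 1
        a-constant = length-norm-1⇒constant {a}
          (coprime (norm a) (norm-normal a)
            (e , ≋⇒≈ (≋-trans (⊗-congˡ e (norm-≋ a)) ae≋P))
            (r , ≋⇒≈ (≋-trans (⊗-congˡ r (norm-≋ a)) (≋-trans (⊗-comm a r) (≋-sym Q≋ra)))))
        ra-top : coeff (r ⊗ a) dQ ≡ 0#
        ra-top = trans (at (⊗-comm r a) dQ) (bounded-⊗ a r 0 dQ a-constant r<dQ dQ ≤-refl)

      euclid : ∀ d → Q∣ (P ⊗ d) → Q∣ d
      euclid d Q∣Pd = t , ≋-sym (exact-if-zero ρ≋0)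
        where
        open Division (divide Q Q-exact d)
          renaming (quotient to t; remainder to ρ; remainder-small to ρ<dQ)
        ρ≋0 : ρ ≋ []
        ρ≋0 = no-small-solution dQ ρ ρ<dQ ρ<dQ
                (Q∣-≋ (⊗-congʳ P remainder-≋) (Q∣P⊗-⊖ Q∣Pd (Q∣P⊗-⊗ t Q∣P⊗Q)))

      -- Rigidity: an orbit of d ↦ (P/Q)·d starts at 0.  Every term is
      -- divisible by Q (Euclid), the quotients form an orbit again, and
      -- since deg Q ≥ 1 their degree is smaller; descend on a degree bound.
      orbit-quotient : ∀ d → Orbit d → Σ (ℕ → Raw) λ f → (∀ n → Q ⊗ f n ≋ d n) × Orbit f
      orbit-quotient d orbit = f , Qf≋d , f-orbit
        where
        Q∣d : ∀ n → Q∣ (d n)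
        Q∣d n = euclid (d n) (d (suc n) , orbit n)
        f : ℕ → Raw
        f n = proj₁ (Q∣d n)
        Qf≋d : ∀ n → Q ⊗ f n ≋ d n
        Qf≋d n = proj₂ (Q∣d n)
        f-orbit : Orbit f
        f-orbit n = ⊗-cancelˡ {Q} Q-exact (begin
          Q ⊗ (Q ⊗ f (suc n))   ≈⟨ ⊗-congʳ Q (Qf≋d (suc n)) ⟩
          Q ⊗ d (suc n)         ≈⟨ orbit n ⟩
          P ⊗ d n               ≈⟨ ⊗-congʳ P (Qf≋d n) ⟨
          P ⊗ (Q ⊗ f n)         ≈⟨ ⊗-assoc P Q (f n) ⟨
          (P ⊗ Q) ⊗ f n         ≈⟨ ⊗-congˡ (f n) (⊗-comm P Q) ⟩
          (Q ⊗ P) ⊗ f n         ≈⟨ ⊗-assoc Q P (f n) ⟩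
          Q ⊗ (P ⊗ f n)         ∎)
          where open ≋-Reasoning

      rigidity : 1 ≤ dQ → ∀ B d → Bounded (d 0) B → Orbit d → d 0 ≋ []
      rigidity 1≤dQ zero    d d0<B orbit = bounded-zero {d 0} d0<B
      rigidity 1≤dQ (suc B) d d0<B orbit with orbit-quotient d orbit
      ... | f , Qf≋d , f-orbit with zero-or-exact (f 0)
      ...   | inj₁ f0≋0 = ≋-trans (≋-sym (Qf≋d 0)) (≋-trans (⊗-congʳ Q f0≋0) (⊗-zeroʳ Q))
      ...   | inj₂ (e , f0≢0 , f0<1+e) =
              contradiction (rigidity 1≤dQ B f f0<B f-orbit) (exact-nonzero {f 0} (f0≢0 , f0<1+e))
        where
        -- deg d₀ = deg Q + deg f₀ < B + 1 and deg Q ≥ 1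
        dQ+e<1+B : dQ + e < suc B
        dQ+e<1+B = nonzero-below-bound {d 0}
                     (proj₁ (exact-≋ (Qf≋d 0) (exact-⊗ {Q} {f 0} Q-exact (f0≢0 , f0<1+e)))) d0<B
        f0<B : Bounded (f 0) B
        f0<B = bounded-mono {f 0} (≤-trans (+-monoˡ-≤ e 1≤dQ) (≤-pred dQ+e<1+B)) f0<1+e

  -- The greedy path: from a vertex v of degree e, divide P·v by Q and
  -- take the digit cancelling the remainder; the new vertex has degree
  -- e + deg P − deg Q > e.
  module Greedy {dP dQ : ℕ} (P-normal : Normal P) (P-length : length P ≡ suc dP)
                (Q-normal : Normal Q) (Q-length : length Q ≡ suc dQ) (dQ<dP : dQ < dP) where

    P-exact : Exact P dP
    P-exact = normal-exact P-normal P-length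

    Q-exact : Exact Q dQ
    Q-exact = normal-exact Q-normal Q-length

    small-digit : ∀ s → Bounded s dP → Digit P
    small-digit s s<dP =
      norm s , norm-normal s , subst (length (norm s) <_) (sym P-length) (s≤s (length-norm-≤ {s} s<dP))

    large-cofactor : ∀ t {e} → ¬ coeff (Q ⊗ t) (dP + e) ≡ 0# → ∃[ f ] Exact t f × e < f
    large-cofactor t {e} Qt-top≢0 with zero-or-exact t
    ... | inj₁ t≋0           =
          contradiction (at (≋-trans (⊗-congʳ Q t≋0) (⊗-zeroʳ Q)) (dP + e)) Qt-top≢0
    ... | inj₂ (f , t-exact) = f , t-exact , ≰⇒> f≰e
      where
      dP+e<1+dQ+f : dP + e < suc (dQ + f)
      dP+e<1+dQ+f = nonzero-below-bound {Q ⊗ t} Qt-top≢0 (proj₂ (exact-⊗ {Q} {t} Q-exact t-exact))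
      f≰e : ¬ f ≤ e
      f≰e f≤e = <⇒≱ (+-mono-<-≤ dQ<dP f≤e) (≤-pred dP+e<1+dQ+f)

    record GreedyEdge (v : Raw) (e : ℕ) : Set where
      field
        label         : Digit P
        target        : Raw
        target-degree : ℕ
        target-exact  : Exact target target-degree
        grows         : e < target-degree
        edge          : v ─[ digit {P} label ]→ target

    greedy-edge : ∀ v {e} → Exact v e → GreedyEdge v e
    greedy-edge v {e} v-exact = record
      { label = label ; target = t ; edge = edge
      ; target-degree = proj₁ t-large ; target-exact = proj₁ (proj₂ t-large) ; grows = proj₂ (proj₂ t-large) }
      where
      open Division (divide Q Q-exact (P ⊗ v))
        renaming (quotient to t; remainder to ρ; identity to Pv≋Qt+ρ; remainder-small to ρ<dQ)
      label : Digit P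
      label = small-digit (neg ρ) (bounded-mono {neg ρ} (<⇒≤ dQ<dP) (bounded-neg {ρ} ρ<dQ))
      edge : v ─[ digit {P} label ]→ t
      edge = begin
        Q ⊗ t                   ≈⟨ ⊕-⊖-cancel (Q ⊗ t) ρ ⟨
        ((Q ⊗ t) ⊕ ρ) ⊖ ρ       ≈⟨ ⊖-cong (≋-sym Pv≋Qt+ρ) (≋-refl {ρ}) ⟩
        (P ⊗ v) ⊕ neg ρ         ≈⟨ ⊕-cong (≋-refl {P ⊗ v}) (norm-≋ (neg ρ)) ⟨
        (P ⊗ v) ⊕ norm (neg ρ)  ∎
        where open ≋-Reasoning
      -- the top coefficient of P·v survives in Q·t, as deg ρ < deg Q ≤ deg (P·v)
      Qt-top≢0 : ¬ coeff (Q ⊗ t) (dP + e) ≡ 0#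
      Qt-top≢0 Qt-top≡0 = proj₁ (exact-⊗ {P} {v} P-exact v-exact) (begin
        coeff (P ⊗ v) (dP + e)                       ≡⟨ at Pv≋Qt+ρ (dP + e) ⟩
        coeff ((Q ⊗ t) ⊕ ρ) (dP + e)                 ≡⟨ coeff-⊕ (Q ⊗ t) ρ (dP + e) ⟩
        coeff (Q ⊗ t) (dP + e) +F coeff ρ (dP + e)   ≡⟨ cong₂ _+F_ Qt-top≡0 ρ-top ⟩
        0# +F 0#                                     ≡⟨ +-identityʳ 0# ⟩
        0#                                           ∎)
        where
        open ≡-Reasoning
        ρ-top : coeff ρ (dP + e) ≡ 0#
        ρ-top = ρ<dQ (dP + e) (≤-trans (<⇒≤ dQ<dP) (m≤m+n dP e))
      t-large : ∃[ f ] Exact t f × e < f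
      t-large = large-cofactor t Qt-top≢0

    record Vertex : Set where
      constructor vertex
      field
        poly   : Raw
        degree : ℕ
        exact  : Exact poly degree
    open Vertex

    next : Vertex → Vertex
    next (vertex v e v-exact) = vertex target target-degree target-exact
      where open GreedyEdge (greedy-edge v v-exact)

    -- the vertices after the first edge 0 ─[ Q ]→ 1
    greedy-vertex : ℕ → Vertex
    greedy-vertex zero    = vertex (1# ∷ []) 0 ((λ 1≡0 → 0≢1 (sym 1≡0)) , λ { (suc k) _ → refl })
    greedy-vertex (suc n) = next (greedy-vertex n)

    greedy-edge-at : ∀ n → GreedyEdge (poly (greedy-vertex n)) (degree (greedy-vertex n))
    greedy-edge-at n = greedy-edge (poly (greedy-vertex n)) (exact (greedy-vertex n))

    greedy-path : ℕ → Raw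
    greedy-path zero    = []
    greedy-path (suc n) = poly (greedy-vertex n)

    greedy-word : ℕ → Digit P
    greedy-word zero    = Q , Q-normal , subst₂ _<_ (sym Q-length) (sym P-length) (s≤s dQ<dP)
    greedy-word (suc n) = GreedyEdge.label (greedy-edge-at n)

    greedy-edges : ∀ n → greedy-path n ─[ digit {P} (greedy-word n) ]→ greedy-path (suc n)
    greedy-edges zero    = begin
      Q ⊗ (1# ∷ [])     ≈⟨ ⊗-comm Q (1# ∷ []) ⟩
      (1# ∷ []) ⊗ Q     ≈⟨ ⊗-identityˡ Q ⟩
      Q                 ≈⟨ ⊕-cong (⊗-zeroʳ P) (≋-refl {Q}) ⟨
      (P ⊗ []) ⊕ Q      ∎
      where open ≋-Reasoning
    greedy-edges (suc n) = GreedyEdge.edge (greedy-edge-at n)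

    greedy-word∈W : W P Q greedy-word
    greedy-word∈W = greedy-path , refl , λ i → ≋⇒≈ (greedy-edges i)

    degree-increasing : ∀ {i j} → i < j → degree (greedy-vertex i) < degree (greedy-vertex j)
    degree-increasing {i} {suc j} i<1+j with m≤n⇒m<n∨m≡n (≤-pred i<1+j)
    ... | inj₁ i<j  = <-trans (degree-increasing i<j) (GreedyEdge.grows (greedy-edge-at j))
    ... | inj₂ refl = GreedyEdge.grows (greedy-edge-at i)

    greedy-path-injective : ∀ {i j} → i < j → ¬ greedy-path i ≋ greedy-path j
    greedy-path-injective {zero}  {suc j} _         e = exact-nonzero (exact (greedy-vertex j)) (≋-sym e)
    greedy-path-injective {suc i} {suc j} (s≤s i<j) e =
      proj₁ (exact (greedy-vertex j))
        (trans (sym (at e _)) (proj₂ (exact (greedy-vertex i)) _ (degree-increasing i<j)))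

    module _ (coprime : Coprime P Q) (1≤dQ : 1 ≤ dQ) where

      -- Cutting a segment [a, b) out of the greedy word leaves W_{P/Q}:
      -- a path u reading the cut word follows the greedy path up to time a
      -- (determinism) and then differs from its tail after time b by an
      -- orbit of d ↦ (P/Q)·d, which must vanish (rigidity); so the greedy
      -- path would visit the same vertex at times a and b.
      cut-greedy-word∉W : ∀ {a b} → a < b → (g : ℕ → ℕ) →
                          (∀ {k} → k < a → g k ≡ k) → (∀ n → g (n + a) ≡ n + b) →
                          ¬ W P Q (greedy-word ∘ g)
      cut-greedy-word∉W {a} {b} a<b g g-below g-shift (u , u0≈0 , u-edges) =
        greedy-path-injective a<b (≋-trans (≋-sym (prefix a ≤-refl)) ua≋vb)
        where
        u-edge : ∀ {k j} → g k ≡ j → u k ─[ digit {P} (greedy-word j) ]→ u (suc k)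
        u-edge {k} refl = ≈⇒≋ (u-edges k)

        prefix : ∀ k → k ≤ a → u k ≋ greedy-path k
        prefix zero    _     = ≈⇒≋ u0≈0
        prefix (suc k) k<a = edge-deterministic Q-exact (u-edge (g-below k<a)) (greedy-edges k)
                               (prefix k (<⇒≤ k<a))

        difference : ℕ → Raw
        difference n = u (n + a) ⊖ greedy-path (n + b)

        difference-orbit : Orbit difference
        difference-orbit n = edge-difference (u-edge (g-shift n)) (greedy-edges (n + b))

        ua≋vb : u a ≋ greedy-path b
        ua≋vb = ⊖-zero⇒≋ (rigidity Q-exact coprime 1≤dQ (length (difference 0)) difference
                            (bounded-length (difference 0)) difference-orbit)

degrees-of-lengths : ∀ {ℓQ ℓP} → 2 ≤ ℓQ → ℓQ < ℓP →
                     ∃[ dP ] ∃[ dQ ] (ℓP ≡ suc dP × ℓQ ≡ suc dQ × 1 ≤ dQ × dQ < dP)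
degrees-of-lengths (s≤s (s≤s z≤n)) (s≤s dQ<dP) = _ , _ , refl , refl , s≤s z≤n , dQ<dP

theorem4p6 : (F : FiniteField) → let open Poly F in
    (P Q : Raw) → Normal P → Normal Q →
    length Q < length P → 2 ≤ length Q →
    Coprime P Q →
    ¬ RegularΩ (W P Q)
theorem4p6 F P Q P-normal Q-normal ℓQ<ℓP 2≤ℓQ coprime (B , recognises)
  with degrees-of-lengths 2≤ℓQ ℓQ<ℓP
... | dP , dQ , P-length , Q-length , 1≤dQ , dQ<dP = refute (pump-down greedy-accepted)
  where
  open PumpingDown B
  open ExpansionGraph F P Q
  open Greedy P-normal P-length Q-normal Q-length dQ<dP

  greedy-accepted : Accepts B greedy-word
  greedy-accepted = proj₁ (recognises greedy-word) greedy-word∈W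

  refute : ∃[ a ] ∃[ b ] a < b × Accepts B (greedy-word ∘ skip a b) → ⊥
  refute (a , b , a<b , cut-accepted) =
    cut-greedy-word∉W coprime 1≤dQ a<b (skip a b) skip-below (skip-shift a b)
      (proj₂ (recognises (greedy-word ∘ skip a b)) cut-accepted)
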